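{- Let $H$ be a finite loopless multigraph containing an NE-gadget with terminals $x$ and $y$. Then in every FO2-coloring of $H$, the vertices $x$ and $y$ receive different colors.
   Context: Multigraphs may have parallel edges but no loops. A functional orientation of $H$ is an assignment of directions to a set of edges such that every vertex of positive degree has exactly one edge directed away from it; an edge may be assigned both directions or remain undirected. A 2-coloring is a partition of $V(H)$ into two color classes (not necessarily independent). An FO2-coloring of $H$ is a 2-coloring for which some functional orientation directs every edge whose endpoints have the same color in at least one direction. An EQ-gadget with terminals $u,w$ consists of $u,w$ and seven further private vertices $\gamma,\alpha,\beta,a,b,c,d$ with edges: two parallel edges $u\gamma$, two parallel edges $w\gamma$, single edges $\gamma\alpha,\alpha\beta,\beta\gamma$, two parallel edges $\alpha a$, two parallel edges $\alpha b$, three parallel edges $ab$, two parallel edges $\beta c$, two parallel edges $\beta d$, three parallel edges $cd$. An NE-gadget with terminals $x,y$ consists of distinct vertices $x,p,q,y$, an EQ-gadget with terminals $x,p$, three parallel edges $pq$, and an EQ-gadget with terminals $q,y$ (the two EQ-gadgets having disjoint sets of private vertices). $H$ contains a gadget if all its vertices and edges belong to $H$ and every non-terminal vertex of the gadget (here $p,q$ and all private vertices of the EQ-gadgets) is incident in $H$ only to edges of the gadget; the terminals may have further edges in $H$. -}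

module Defs where

open import Data.Nat using (ℕ)
open import Data.Fin using (Fin)
open import Data.Bool using (Bool; true)
open import Data.List using (List; []; _∷_; _++_; length; lookup)
open import Data.Product using (_×_; _,_; proj₁; proj₂; Σ; ∃)
open import Data.Sum using (_⊎_)
open import Relation.Binary.PropositionalEquality using (_≡_; _≢_)

-- A finite loopless multigraph: vertices Fin n, edges Fin m (so parallel
-- edges are distinguished), each edge has two distinct endpoints.
record Multigraph : Set where
  field
    n : ℕ
    m : ℕ
    ends : Fin m → Fin n × Fin n
    loopless : ∀ e → proj₁ (ends e) ≢ proj₂ (ends e)

module _ (H : Multigraph) where
  open Multigraph H

  src tgt : Fin m → Fin n
  src e = proj₁ (ends e)
  tgt e = proj₂ (ends e)

  Incident : Fin m → Fin n → Set
  Incident e v = (src e ≡ v) ⊎ (tgt e ≡ v)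

  PositiveDegree : Fin n → Set
  PositiveDegree v = ∃ λ e → Incident e v

  -- An assignment of directions to edges: fwd e = directed src→tgt,
  -- bwd e = directed tgt→src; both, or neither, are allowed.
  record Directions : Set where
    field
      fwd : Fin m → Bool
      bwd : Fin m → Bool

  DirectedAway : Directions → Fin n → Fin m → Set
  DirectedAway D v e =
    (src e ≡ v × Directions.fwd D e ≡ true) ⊎ (tgt e ≡ v × Directions.bwd D e ≡ true)

  IsFunctionalOrientation : Directions → Set
  IsFunctionalOrientation D =
    ∀ v → PositiveDegree v →
      ∃ λ e → DirectedAway D v e × (∀ e' → DirectedAway D v e' → e' ≡ e)

  Directed : Directions → Fin m → Set
  Directed D e = (Directions.fwd D e ≡ true) ⊎ (Directions.bwd D e ≡ true)

  IsFO2Coloring : (Fin n → Bool) → Set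
  IsFO2Coloring col =
    Σ Directions λ D → IsFunctionalOrientation D ×
      (∀ e → col (src e) ≡ col (tgt e) → Directed D e)

data EQPriv : Set where
  γ α β a b c d : EQPriv

data NEV : Set where
  vx vp vq vy : NEV
  L R : EQPriv → NEV

-- Edges of an EQ-gadget with terminals u, w and private vertices given by P
eqEdges : NEV → NEV → (EQPriv → NEV) → List (NEV × NEV)
eqEdges u w P =
  (u , P γ) ∷ (u , P γ) ∷
  (w , P γ) ∷ (w , P γ) ∷
  (P γ , P α) ∷ (P α , P β) ∷ (P β , P γ) ∷
  (P α , P a) ∷ (P α , P a) ∷
  (P α , P b) ∷ (P α , P b) ∷
  (P a , P b) ∷ (P a , P b) ∷ (P a , P b) ∷
  (P β , P c) ∷ (P β , P c) ∷
  (P β , P d) ∷ (P β , P d) ∷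
  (P c , P d) ∷ (P c , P d) ∷ (P c , P d) ∷ []

neEdges : List (NEV × NEV)
neEdges = eqEdges vx vp L ++ ((vp , vq) ∷ (vp , vq) ∷ (vp , vq) ∷ []) ++ eqEdges vq vy R

record ContainsNE (H : Multigraph) : Set where
  open Multigraph H
  field
    φ : NEV → Fin n
    φ-inj : ∀ u v → φ u ≡ φ v → u ≡ v
    ψ : Fin (length neEdges) → Fin m
    ψ-inj : ∀ i j → ψ i ≡ ψ j → i ≡ j
    ψ-ends : ∀ i →
      (ends (ψ i) ≡ (φ (proj₁ (lookup neEdges i)) , φ (proj₂ (lookup neEdges i))))
      ⊎ (ends (ψ i) ≡ (φ (proj₂ (lookup neEdges i)) , φ (proj₁ (lookup neEdges i))))
    private-closed : ∀ g → g ≢ vx → g ≢ vy →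
      ∀ e → Incident H e (φ g) → ∃ λ i → ψ i ≡ e

module Submission where

-- Only one consequence of a functional orientation is used: no vertex
-- directs two different edges away from itself ("out-uniqueness").  Combined
-- with the rule that monochromatic edges are directed, this gives three local
-- facts about parallel edges between s and t:
--   * a monochromatic double edge makes s direct one of its two edges, so s
--     directs nothing else;
--   * a triple edge cannot be monochromatic (two of its edges would leave the
--     same endpoint);
--   * a vertex doubly joined to both ends of a bichromatic pair directs none
--     of its other edges.
-- In an EQ-gadget the triple edges make a/b and c/d bichromatic, so α and β
-- are silent on the triangle; hence α, β differ, γ shares a color with one
-- of them and must direct the triangle edge towards it; so γ differs from
-- both terminals u, w, which therefore agree.  An NE-gadget chains
-- EQ(x,p), a triple edge pq (p ≠ q) and EQ(q,y), so x ≠ y.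

open import Defs
open import Data.Fin using (Fin; zero; suc; #_)
open import Data.Fin.Properties using (suc-injective)
open import Data.Bool using (Bool)
open import Data.Bool.Properties using (_≟_; ¬-not)
open import Data.List using (List; []; _∷_; _++_; length; lookup)
open import Data.Product using (_×_; _,_; proj₁; proj₂)
open import Data.Sum using (_⊎_; inj₁; inj₂; [_,_]′)
open import Function using (_∘_)
open import Function.Definitions using (Injective)
open import Relation.Nullary using (¬_; yes; no; contradiction)
open import Relation.Binary.PropositionalEquality

bool-either : ∀ {x y} (z : Bool) → x ≢ y → z ≡ x ⊎ z ≡ y
bool-either {x} {y} z x≢y with z ≟ x
... | yes z≡x = inj₁ z≡x
... | no  z≢x = inj₂ (trans (¬-not z≢x) (sym (¬-not (x≢y ∘ sym))))

bool-third : ∀ {x y z : Bool} → x ≢ z → y ≢ z → x ≡ y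
bool-third x≢z y≢z = trans (¬-not x≢z) (sym (¬-not y≢z))

module _ {A : Set} where

  left-index : (xs ys : List A) → Fin (length xs) → Fin (length (xs ++ ys))
  left-index (x ∷ xs) ys zero    = zero
  left-index (x ∷ xs) ys (suc i) = suc (left-index xs ys i)

  right-index : (xs ys : List A) → Fin (length ys) → Fin (length (xs ++ ys))
  right-index []       ys i = i
  right-index (x ∷ xs) ys i = suc (right-index xs ys i)

  lookup-left : (xs ys : List A) (i : Fin (length xs)) →
                lookup (xs ++ ys) (left-index xs ys i) ≡ lookup xs i
  lookup-left (x ∷ xs) ys zero    = refl
  lookup-left (x ∷ xs) ys (suc i) = lookup-left xs ys i

  lookup-right : (xs ys : List A) (i : Fin (length ys)) →
                 lookup (xs ++ ys) (right-index xs ys i) ≡ lookup ys i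
  lookup-right []       ys i = refl
  lookup-right (x ∷ xs) ys i = lookup-right xs ys i

  left-index-injective : (xs ys : List A) → Injective _≡_ _≡_ (left-index xs ys)
  left-index-injective (x ∷ xs) ys {zero}  {zero}  _ = refl
  left-index-injective (x ∷ xs) ys {suc i} {suc j} p =
    cong suc (left-index-injective xs ys (suc-injective p))

  right-index-injective : (xs ys : List A) → Injective _≡_ _≡_ (right-index xs ys)
  right-index-injective []       ys p = p
  right-index-injective (x ∷ xs) ys p = right-index-injective xs ys (suc-injective p)

module _ (H : Multigraph) where
  open Multigraph H

  Joins : Fin m → Fin n → Fin n → Set
  Joins e s t = (ends e ≡ (s , t)) ⊎ (ends e ≡ (t , s))

  Joins-sym : ∀ {e s t} → Joins e s t → Joins e t s
  Joins-sym (inj₁ p) = inj₂ p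
  Joins-sym (inj₂ p) = inj₁ p

  record EdgeEmbedding {V : Set} (φ : V → Fin n) (es : List (V × V)) : Set where
    field
      edge           : Fin (length es) → Fin m
      edge-injective : Injective _≡_ _≡_ edge
      edge-joins     : ∀ i → Joins (edge i) (φ (proj₁ (lookup es i))) (φ (proj₂ (lookup es i)))

  module _ {V : Set} {φ : V → Fin n} where
    open EdgeEmbedding

    restrictˡ : ∀ xs ys → EdgeEmbedding φ (xs ++ ys) → EdgeEmbedding φ xs
    restrictˡ xs ys E .edge             = edge E ∘ left-index xs ys
    restrictˡ xs ys E .edge-injective p = left-index-injective xs ys (edge-injective E p)
    restrictˡ xs ys E .edge-joins i     =
      subst (λ st → Joins (edge E (left-index xs ys i)) (φ (proj₁ st)) (φ (proj₂ st)))
            (lookup-left xs ys i) (edge-joins E (left-index xs ys i))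

    restrictʳ : ∀ xs ys → EdgeEmbedding φ (xs ++ ys) → EdgeEmbedding φ ys
    restrictʳ xs ys E .edge             = edge E ∘ right-index xs ys
    restrictʳ xs ys E .edge-injective p = right-index-injective xs ys (edge-injective E p)
    restrictʳ xs ys E .edge-joins i     =
      subst (λ st → Joins (edge E (right-index xs ys i)) (φ (proj₁ st)) (φ (proj₂ st)))
            (lookup-right xs ys i) (edge-joins E (right-index xs ys i))

  away-incident : ∀ {D v e} → DirectedAway H D v e → Incident H e v
  away-incident (inj₁ (p , _)) = inj₁ p
  away-incident (inj₂ (p , _)) = inj₂ p

  functional⇒out-unique : ∀ {D} → IsFunctionalOrientation H D →
    ∀ {v e e'} → DirectedAway H D v e → DirectedAway H D v e' → e ≡ e'
  functional⇒out-unique {D} FO {v} {e} {e'} h h' with FO v (e , away-incident {D} h)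
  ... | _ , _ , unique = trans (unique e h) (sym (unique e' h'))

  ne-embedding : (G : ContainsNE H) → EdgeEmbedding (ContainsNE.φ G) neEdges
  ne-embedding G = record
    { edge = ψ ; edge-injective = ψ-inj _ _ ; edge-joins = ψ-ends }
    where open ContainsNE G

module Orientation (H : Multigraph) (col : Fin (Multigraph.n H) → Bool)
  (D : Directions H)
  (out-unique : ∀ {v e e'} → DirectedAway H D v e → DirectedAway H D v e' → e ≡ e')
  (mono-directed : ∀ e → col (src H e) ≡ col (tgt H e) → Directed H D e) where
  open Multigraph H

  Away : Fin n → Fin m → Set
  Away = DirectedAway H D

  Double : Fin m → Fin m → Fin n → Fin n → Set
  Double e₁ e₂ s t = e₁ ≢ e₂ × Joins H e₁ s t × Joins H e₂ s t

  Double-sym : ∀ {e₁ e₂ s t} → Double e₁ e₂ s t → Double e₁ e₂ t s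
  Double-sym (e₁≢e₂ , j₁ , j₂) = e₁≢e₂ , Joins-sym H j₁ , Joins-sym H j₂

  mono-away : ∀ {e s t} → Joins H e s t → col s ≡ col t → Away s e ⊎ Away t e
  mono-away {e} (inj₁ p) eq
    with mono-directed e (trans (cong (col ∘ proj₁) p) (trans eq (sym (cong (col ∘ proj₂) p))))
  ... | inj₁ fw = inj₁ (inj₁ (cong proj₁ p , fw))
  ... | inj₂ bw = inj₂ (inj₂ (cong proj₂ p , bw))
  mono-away {e} (inj₂ p) eq
    with mono-directed e (trans (cong (col ∘ proj₁) p) (trans (sym eq) (sym (cong (col ∘ proj₂) p))))
  ... | inj₁ fw = inj₂ (inj₁ (cong proj₁ p , fw))
  ... | inj₂ bw = inj₁ (inj₂ (cong proj₂ p , bw))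

  forced-away : ∀ {e s t} → Joins H e s t → col s ≡ col t → ¬ Away t e → Away s e
  forced-away j eq silent = [ (λ h → h) , (λ h → contradiction h silent) ]′ (mono-away j eq)

  silent-bichromatic : ∀ {e s t} → Joins H e s t → ¬ Away s e → ¬ Away t e → col s ≢ col t
  silent-bichromatic j ¬s ¬t eq = [ ¬s , ¬t ]′ (mono-away j eq)

  -- One edge of a monochromatic double edge is directed away from s (the two
  -- edges cannot both leave t).
  double-away : ∀ {e₁ e₂ s t} → Double e₁ e₂ s t → col s ≡ col t → Away s e₁ ⊎ Away s e₂
  double-away (e₁≢e₂ , j₁ , j₂) eq with mono-away j₁ eq | mono-away j₂ eq
  ... | inj₁ s₁ | _       = inj₁ s₁
  ... | inj₂ t₁ | inj₁ s₂ = inj₂ s₂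
  ... | inj₂ t₁ | inj₂ t₂ = contradiction (out-unique t₁ t₂) e₁≢e₂

  double-silent : ∀ {e₁ e₂ s t e} → Double e₁ e₂ s t → col s ≡ col t →
                  e ≢ e₁ → e ≢ e₂ → ¬ Away s e
  double-silent dbl eq e≢e₁ e≢e₂ h =
    [ e≢e₁ ∘ out-unique h , e≢e₂ ∘ out-unique h ]′ (double-away dbl eq)

  triple-bichromatic : ∀ {e₁ e₂ e₃ s t} → Double e₁ e₂ s t →
                       e₃ ≢ e₁ → e₃ ≢ e₂ → Joins H e₃ s t → col s ≢ col t
  triple-bichromatic dbl e₃≢e₁ e₃≢e₂ j₃ eq with mono-away j₃ eq
  ... | inj₁ s₃ = double-silent dbl eq e₃≢e₁ e₃≢e₂ s₃
  ... | inj₂ t₃ = double-silent (Double-sym dbl) (sym eq) e₃≢e₁ e₃≢e₂ t₃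

  -- A vertex doubly joined to both ends of a bichromatic pair a, b shares a
  -- color with one of them, so it directs none of its other edges.
  hub-silent : ∀ {v a b e₁ e₂ e₃ e₄ e} → col a ≢ col b →
               Double e₁ e₂ v a → Double e₃ e₄ v b →
               e ≢ e₁ → e ≢ e₂ → e ≢ e₃ → e ≢ e₄ → ¬ Away v e
  hub-silent {v} a≢b va vb e≢e₁ e≢e₂ e≢e₃ e≢e₄ with bool-either (col v) a≢b
  ... | inj₁ v≡a = double-silent va v≡a e≢e₁ e≢e₂
  ... | inj₂ v≡b = double-silent vb v≡b e≢e₃ e≢e₄

  -- An EQ-gadget forces equal colors on its terminals.  Edge indices follow
  -- the order of  eqEdges:  0,1 uγ; 2,3 wγ; 4 γα; 5 αβ; 6 βγ; 7,8 αa;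
  -- 9,10 αb; 11-13 ab; 14,15 βc; 16,17 βd; 18-20 cd.
  module EQGadget {φ : NEV → Fin n} {u w : NEV} {P : EQPriv → NEV}
    (E : EdgeEmbedding H φ (eqEdges u w P)) where
    open EdgeEmbedding E

    v : EQPriv → Fin n
    v = φ ∘ P

    e : Fin 21 → Fin m
    e = edge

    distinct : ∀ {i j} → i ≢ j → e i ≢ e j
    distinct i≢j = i≢j ∘ edge-injective

    a≢b : col (v a) ≢ col (v b)
    a≢b = triple-bichromatic (distinct (λ ()) , edge-joins (# 11) , edge-joins (# 12))
            (distinct (λ ())) (distinct (λ ())) (edge-joins (# 13))

    c≢d : col (v c) ≢ col (v d)
    c≢d = triple-bichromatic (distinct (λ ()) , edge-joins (# 18) , edge-joins (# 19))
            (distinct (λ ())) (distinct (λ ())) (edge-joins (# 20))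

    α-silent : ∀ {i} → i ≢ # 7 → i ≢ # 8 → i ≢ # 9 → i ≢ # 10 → ¬ Away (v α) (e i)
    α-silent p q r s =
      hub-silent a≢b (distinct (λ ()) , edge-joins (# 7) , edge-joins (# 8))
                     (distinct (λ ()) , edge-joins (# 9) , edge-joins (# 10))
                     (distinct p) (distinct q) (distinct r) (distinct s)

    β-silent : ∀ {i} → i ≢ # 14 → i ≢ # 15 → i ≢ # 16 → i ≢ # 17 → ¬ Away (v β) (e i)
    β-silent p q r s =
      hub-silent c≢d (distinct (λ ()) , edge-joins (# 14) , edge-joins (# 15))
                     (distinct (λ ()) , edge-joins (# 16) , edge-joins (# 17))
                     (distinct p) (distinct q) (distinct r) (distinct s)

    α≢β : col (v α) ≢ col (v β)
    α≢β = silent-bichromatic (edge-joins (# 5))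
            (α-silent (λ ()) (λ ()) (λ ()) (λ ())) (β-silent (λ ()) (λ ()) (λ ()) (λ ()))

    -- γ matches α or β, and must direct the triangle edge towards it.
    γ-away : Away (v γ) (e (# 4)) ⊎ Away (v γ) (e (# 6))
    γ-away with bool-either (col (v γ)) α≢β
    ... | inj₁ γ≡α = inj₁ (forced-away (edge-joins (# 4)) γ≡α (α-silent (λ ()) (λ ()) (λ ()) (λ ())))
    ... | inj₂ γ≡β = inj₂ (forced-away (Joins-sym H (edge-joins (# 6))) γ≡β
                                       (β-silent (λ ()) (λ ()) (λ ()) (λ ())))

    -- γ is busy on the triangle, so it differs from a terminal doubly joined to it.
    γ-differs : ∀ {t i j} → i ≢ j → Joins H (e i) t (v γ) → Joins H (e j) t (v γ) →
                # 4 ≢ i → # 4 ≢ j → # 6 ≢ i → # 6 ≢ j → col t ≢ col (v γ)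
    γ-differs {t} {i} {j} i≢j ji jj 4≢i 4≢j 6≢i 6≢j t≡γ =
      [ double-silent dbl (sym t≡γ) (distinct 4≢i) (distinct 4≢j)
      , double-silent dbl (sym t≡γ) (distinct 6≢i) (distinct 6≢j) ]′ γ-away
      where
      dbl : Double (e i) (e j) (v γ) t
      dbl = Double-sym (distinct i≢j , ji , jj)

    terminals-equal : col (φ u) ≡ col (φ w)
    terminals-equal = bool-third
      (γ-differs (λ ()) (edge-joins (# 0)) (edge-joins (# 1)) (λ ()) (λ ()) (λ ()) (λ ()))
      (γ-differs (λ ()) (edge-joins (# 2)) (edge-joins (# 3)) (λ ()) (λ ()) (λ ()) (λ ()))

  ne-gadget-differ : ∀ {φ : NEV → Fin n} → EdgeEmbedding H φ neEdges → col (φ vx) ≢ col (φ vy)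
  ne-gadget-differ {φ} E x≡y = p≢q (trans (sym x≡p) (trans x≡y (sym q≡y)))
    where
    eqˣ pq eqʸ : List (NEV × NEV)
    eqˣ = eqEdges vx vp L
    pq  = (vp , vq) ∷ (vp , vq) ∷ (vp , vq) ∷ []
    eqʸ = eqEdges vq vy R

    rest : EdgeEmbedding H φ (pq ++ eqʸ)
    rest = restrictʳ H eqˣ (pq ++ eqʸ) E
    open EdgeEmbedding (restrictˡ H pq eqʸ rest)

    x≡p : col (φ vx) ≡ col (φ vp)
    x≡p = EQGadget.terminals-equal {u = vx} {vp} {L} (restrictˡ H eqˣ (pq ++ eqʸ) E)

    q≡y : col (φ vq) ≡ col (φ vy)
    q≡y = EQGadget.terminals-equal {u = vq} {vy} {R} (restrictʳ H pq eqʸ rest)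

    p≢q : col (φ vp) ≢ col (φ vq)
    p≢q = triple-bichromatic
      ((λ ()) ∘ edge-injective , edge-joins (# 0) , edge-joins (# 1))
      ((λ ()) ∘ edge-injective) ((λ ()) ∘ edge-injective) (edge-joins (# 2))

lemma6 : (H : Multigraph) (G : ContainsNE H) (col : Fin (Multigraph.n H) → Bool) →
    IsFO2Coloring H col → col (ContainsNE.φ G vx) ≢ col (ContainsNE.φ G vy)
lemma6 H G col (D , FO , mono-directed) =
  Orientation.ne-gadget-differ H col D (functional⇒out-unique H FO) mono-directed
    (ne-embedding H G)
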